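{- For every $n\in\mathbb{N}$, \[ \mathrm{DN}(\mathrm{FO}[n]),\ \mathrm{LS}(\mathrm{FO}[n]),\ \mathrm{H}(\mathrm{FO}[n]) \le \mathrm{twr}\bigl(n/2+\log^*((n/2)^2+n/2)+1\bigr) \] and \[ \mathrm{DN}(\mathrm{MSO}[n]),\ \mathrm{LS}(\mathrm{MSO}[n]),\ \mathrm{H}(\mathrm{MSO}[n]) \le \mathrm{twr}\bigl(n/2+\log^*((n/2+1)^2)+1\bigr). \]
   Context: Words are nonempty finite words over $\Sigma=\{l,r\}$, identified with word models (positions with linear order $<$ and unary predicates $P_l,P_r$). FO and MSO formulas are over $\{<,P_l,P_r\}$. Size: $\mathrm{sz}(\phi)=1$ for atomic $\phi$; $\mathrm{sz}(\psi\wedge\theta)=\mathrm{sz}(\psi\vee\theta)=\mathrm{sz}(\psi)+\mathrm{sz}(\theta)+1$; $\mathrm{sz}(\neg\psi)$ and $\mathrm{sz}$ of $\exists x\psi,\forall x\psi,\exists U\psi,\forall U\psi$ equal $\mathrm{sz}(\psi)+1$. $\mathrm{FO}[n]$ (resp. $\mathrm{MSO}[n]$) is the set of FO (resp. MSO) formulas of size at most $n$. A sentence $\phi$ defines a word $w$ if $w$ is the only word satisfying $\phi$; $\mathrm{Def}(L)$ is the set of words defined by some sentence of $L$. For a sentence $\phi$: $\mu(\phi)$ is the minimal length of a word satisfying $\phi$ ($0$ if none); $\nu(\phi)$ is the maximal length of a word satisfying $\phi$, and $\nu(\phi)=0$ if $\phi$ has no models or has arbitrarily long models. For a fragment $L$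 (containing finitely many pairwise non-equivalent sentences) with $\mathrm{Def}(L)\neq\emptyset$: $\mathrm{DN}(L)=\max\{|w|: w\in\mathrm{Def}(L)\}$, $\mathrm{LS}(L)=\max\{\mu(\phi):\phi\in L\}$, $\mathrm{H}(L)=\max\{\nu(\phi):\phi\in L\}$. $\mathrm{tower}(0)=1$, $\mathrm{tower}(n+1)=2^{\mathrm{tower}(n)}$; $\mathrm{twr}(x)=\mathrm{tower}(\lceil x\rceil)$; $\log^*(x)$ is the least $m$ with $\mathrm{tower}(m)\ge x$. -}

module Defs where

open import Data.Nat using (ℕ; zero; suc; _+_; _*_; _^_; _≤_; _<_; _≤ᵇ_; _/_)
open import Data.Bool using (Bool; true; false; _∧_; _∨_; not; if_then_else_)
open import Data.Fin using (Fin; zero; suc; _<?_; _≟_)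
open import Data.List using (List; []; _∷_; _++_; map; allFin; lookup)
open import Data.Bool.ListAction using (any; all)
import Data.List as List
open import Data.List.NonEmpty using (List⁺; toList)
open import Data.Product using (Σ; _×_; _,_; ∃)
open import Relation.Binary.PropositionalEquality using (_≡_)
open import Relation.Nullary.Decidable using (⌊_⌋)
import Data.Vec.Functional as VF

data Letter : Set where
  l r : Letter

Word : Set
Word = List⁺ Letter

∣_∣ : Word → ℕ
∣ w ∣ = List.length (toList w)

Pos : Word → Set
Pos w = Fin ∣ w ∣

letterAt : (w : Word) → Pos w → Letter
letterAt w i = lookup (toList w) i

isL isR : Letter → Bool
isL l = true
isL r = false
isR l = false
isR r = true

-- FO / MSO formulas over {<, P_l, P_r} (with equality), de Bruijn style.
-- Formula L k m : k free first-order variables, m free set variables.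

data Logic : Set where
  fo mso : Logic

data Formula : Logic → ℕ → ℕ → Set where
  lt  : ∀ {L k m} → Fin k → Fin k → Formula L k m
  eq  : ∀ {L k m} → Fin k → Fin k → Formula L k m
  Pl  : ∀ {L k m} → Fin k → Formula L k m
  Pr  : ∀ {L k m} → Fin k → Formula L k m
  mem : ∀ {L k m} → Fin m → Fin k → Formula L k m
  neg : ∀ {L k m} → Formula L k m → Formula L k m
  and : ∀ {L k m} → Formula L k m → Formula L k m → Formula L k m
  or  : ∀ {L k m} → Formula L k m → Formula L k m → Formula L k m
  ex1 : ∀ {L k m} → Formula L (suc k) m → Formula L k m
  all1 : ∀ {L k m} → Formula L (suc k) m → Formula L k m
  ex2 : ∀ {k m} → Formula mso k (suc m) → Formula mso k m
  all2 : ∀ {k m} → Formula mso k (suc m) → Formula mso k m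

Sentence : Logic → Set
Sentence L = Formula L 0 0

sz : ∀ {L k m} → Formula L k m → ℕ
sz (lt x y) = 1
sz (eq x y) = 1
sz (Pl x) = 1
sz (Pr x) = 1
sz (mem U x) = 1
sz (neg φ) = suc (sz φ)
sz (and φ ψ) = sz φ + sz ψ + 1
sz (or φ ψ) = sz φ + sz ψ + 1
sz (ex1 φ) = suc (sz φ)
sz (all1 φ) = suc (sz φ)
sz (ex2 φ) = suc (sz φ)
sz (all2 φ) = suc (sz φ)

subsets : (n : ℕ) → List (Fin n → Bool)
subsets zero = (λ ()) ∷ []
subsets (suc n) = map (true VF.∷_) (subsets n) ++ map (false VF.∷_) (subsets n)

eval : ∀ {L k m} (w : Word) → (Fin k → Pos w) → (Fin m → Pos w → Bool) →
       Formula L k m → Bool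
eval w ρ σ (lt x y) = ⌊ ρ x <? ρ y ⌋
eval w ρ σ (eq x y) = ⌊ ρ x ≟ ρ y ⌋
eval w ρ σ (Pl x) = isL (letterAt w (ρ x))
eval w ρ σ (Pr x) = isR (letterAt w (ρ x))
eval w ρ σ (mem U x) = σ U (ρ x)
eval w ρ σ (neg φ) = not (eval w ρ σ φ)
eval w ρ σ (and φ ψ) = eval w ρ σ φ ∧ eval w ρ σ ψ
eval w ρ σ (or φ ψ) = eval w ρ σ φ ∨ eval w ρ σ ψ
eval w ρ σ (ex1 φ) = any (λ i → eval w (i VF.∷ ρ) σ φ) (allFin ∣ w ∣)
eval w ρ σ (all1 φ) = all (λ i → eval w (i VF.∷ ρ) σ φ) (allFin ∣ w ∣)
eval w ρ σ (ex2 φ) = any (λ S → eval w ρ (S VF.∷ σ) φ) (subsets ∣ w ∣)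
eval w ρ σ (all2 φ) = all (λ S → eval w ρ (S VF.∷ σ) φ) (subsets ∣ w ∣)

_⊨_ : ∀ {L} → Word → Sentence L → Set
w ⊨ φ = eval w (λ ()) (λ ()) φ ≡ true

Defines : ∀ {L} → Sentence L → Word → Set
Defines φ w = w ⊨ φ × (∀ v → v ⊨ φ → v ≡ w)

DN≤ : Logic → ℕ → ℕ → Set
DN≤ L n B = ∀ (φ : Sentence L) (w : Word) → sz φ ≤ n → Defines φ w → ∣ w ∣ ≤ B

-- LS(L[n]) ≤ B : every satisfiable sentence of size ≤ n has a model of length ≤ B
-- (i.e. μ(φ) ≤ B for all φ; μ(φ) = 0 for unsatisfiable φ)
LS≤ : Logic → ℕ → ℕ → Set
LS≤ L n B = ∀ (φ : Sentence L) (w : Word) → sz φ ≤ n → w ⊨ φ →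
            Σ Word λ v → v ⊨ φ × ∣ v ∣ ≤ B

-- H(L[n]) ≤ B : ν(φ) ≤ B for all φ of size ≤ n, i.e. if φ has a model longer
-- than B then φ has arbitrarily long models (so ν(φ) = 0)
H≤ : Logic → ℕ → ℕ → Set
H≤ L n B = ∀ (φ : Sentence L) (w : Word) → sz φ ≤ n → w ⊨ φ → B < ∣ w ∣ →
           ∀ (N : ℕ) → Σ Word λ v → v ⊨ φ × N ≤ ∣ v ∣

tower : ℕ → ℕ
tower zero = 1
tower (suc n) = 2 ^ tower n

-- log*(a / b) for b ≥ 1: least m with tower m ≥ a / b, i.e. a ≤ b * tower m.
-- Bounded search starting at m = 0 with fuel a (tower a ≥ a suffices).
logStarFrom : ℕ → ℕ → ℕ → ℕ → ℕ
logStarFrom a b zero m = m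
logStarFrom a b (suc fuel) m =
  if a ≤ᵇ b * tower m then m else logStarFrom a b fuel (suc m)

logStarFrac : ℕ → ℕ → ℕ
logStarFrac a b = logStarFrom a b a 0

ceilHalf : ℕ → ℕ
ceilHalf n = (n + 1) / 2

-- twr(n/2 + log*((n/2)^2 + n/2) + 1) = tower(⌈n/2⌉ + log*((n²+2n)/4) + 1)
boundFO : ℕ → ℕ
boundFO n = tower (ceilHalf n + logStarFrac (n * n + 2 * n) 4 + 1)

-- twr(n/2 + log*((n/2+1)^2) + 1) = tower(⌈n/2⌉ + log*((n+2)²/4) + 1)
boundMSO : ℕ → ℕ
boundMSO n = tower (ceilHalf n + logStarFrac ((n + 2) * (n + 2)) 4 + 1)

{-# OPTIONS --safe #-}
-- A sentence of size n has quantifier rank at most ⌈n/2⌉ once vacuous quantifiers are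
-- not counted. By Ehrenfeucht–Fraïssé games, words of equal rank-q type keep equal types
-- when a common suffix is appended, and there are at most typeCount q rank-q types, each
-- coded as a nested set of atomic diagrams. So a model longer than typeCount q has two
-- prefixes of the same type: cutting out the factor between them gives a shorter model,
-- repeating it gives arbitrarily long ones. This bounds DN, LS and H by typeCount ⌈n/2⌉,
-- a tower of height ⌈n/2⌉ over a square, which log* turns into the stated bound.
module Submission where

open import Defs
import Algebra.Properties.CommutativeSemigroup as CommutativeSemigroupProperties
open import Data.Bool using (Bool; true; false; _∧_; _∨_; not; if_then_else_; T)
open import Data.Bool.ListAction using (any; all)
open import Data.Bool.Properties using (∨-zeroʳ; ∧-zeroʳ)
open import Data.Empty using (⊥-elim)
open import Data.Fin using (Fin; zero; suc; toℕ; combine; funToFin; finToFun)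
open import Data.Fin.Properties as Fin
  using (_<?_; _≟_; combine-injective; finToFun-funToFin; pigeonhole; toℕ<n; toℕ≤pred[n])
open import Data.List using (List; []; _∷_; _++_; length; lookup; allFin; take; drop)
open import Data.List.Membership.Propositional using (_∈_)
open import Data.List.Membership.Propositional.Properties using (∈-allFin; ∈-map⁺; ∈-++⁺ˡ; ∈-++⁺ʳ)
open import Data.List.NonEmpty as List⁺ using (toList)
open import Data.List.Properties using (++-assoc; length-++; length-++-≤ˡ; length-++-≤ʳ; take++drop≡id)
open import Data.List.Relation.Unary.Any using (here; there)
open import Data.Nat using (ℕ; zero; suc; _+_; _*_; _^_; _≤_; _<_; _≤?_; _≤ᵇ_; _⊔_; z≤n; s≤s)
open import Data.Nat.DivMod using (_/_; m*n/n≡m; /-monoˡ-≤; m/n*n≤m; m≥n⇒m/n>0)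
open import Data.Nat.Induction using (<-wellFounded)
open import Data.Nat.Properties hiding (_<?_; _≟_; ≡ᵇ⇒≡)
open import Data.Nat.Solver using (module +-*-Solver)
open import Data.Product using (_×_; ∃; _,_; proj₁; proj₂)
open import Data.Sum using (_⊎_; inj₁; inj₂)
open import Data.Vec.Functional using () renaming (_∷_ to _∷ᶠ_)
open import Function using (_∘_)
open import Induction.WellFounded using (Acc; acc)
open import Relation.Binary.Definitions using (tri<; tri≈; tri>)
open import Relation.Binary.PropositionalEquality
open import Relation.Nullary using (Dec; yes; no; ¬_)
open import Relation.Nullary.Decidable using (⌊_⌋; dec-true; dec-false; isYes≗does)

open +-*-Solver using (solve; _:+_; _:*_; con; _:=_)
open CommutativeSemigroupProperties +-commutativeSemigroup
  using () renaming (interchange to +-interchange; x∙yz≈y∙xz to +-exchange)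

variable
  A B : Set
  L : Logic
  q k m k₂ m₂ n : ℕ

any-witness : (f : A → Bool) (xs : List A) → any f xs ≡ true → ∃ λ x → x ∈ xs × f x ≡ true
any-witness f (x ∷ xs) e with f x in fx
... | true = x , here refl , fx
... | false = let (y , y∈xs , fy) = any-witness f xs e in y , there y∈xs , fy

any-intro : (f : A → Bool) {xs : List A} {x : A} → x ∈ xs → f x ≡ true → any f xs ≡ true
any-intro f (here refl) fx rewrite fx = refl
any-intro f {y ∷ _} (there x∈xs) fx rewrite any-intro f x∈xs fx = ∨-zeroʳ (f y)

all-elim : (f : A → Bool) {xs : List A} {x : A} → all f xs ≡ true → x ∈ xs → f x ≡ true
all-elim f {y ∷ _} e x∈xs with f y in fy
all-elim f e (here refl) | true = fy
all-elim f e (there x∈xs) | true = all-elim f e x∈xs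

all-intro : (f : A → Bool) (xs : List A) → (∀ {x} → x ∈ xs → f x ≡ true) → all f xs ≡ true
all-intro f [] h = refl
all-intro f (y ∷ xs) h rewrite h (here refl) = all-intro f xs (λ x∈xs → h (there x∈xs))

record SameImage (f : A → Bool) (xs : List A) (g : B → Bool) (ys : List B) : Set where
  field
    forth : ∀ {a} → a ∈ xs → ∃ λ b → b ∈ ys × f a ≡ g b
    back  : ∀ {b} → b ∈ ys → ∃ λ a → a ∈ xs × f a ≡ g b

module _ {f : A → Bool} {xs : List A} {g : B → Bool} {ys : List B} (same : SameImage f xs g ys) where
  open SameImage same

  any-cong : any f xs ≡ any g ys
  any-cong with any f xs in e | any g ys in e'
  ... | false | false = refl
  ... | true | _ = let (a , a∈ , fa) = any-witness f xs e ; (b , b∈ , fa≡gb) = forth a∈ in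
                   trans (sym (any-intro g b∈ (trans (sym fa≡gb) fa))) e'
  ... | false | true = let (b , b∈ , gb) = any-witness g ys e' ; (a , a∈ , fa≡gb) = back b∈ in
                       trans (sym e) (any-intro f a∈ (trans fa≡gb gb))

  all-cong : all f xs ≡ all g ys
  all-cong with all f xs in e | all g ys in e'
  ... | true | true = refl
  ... | false | false = refl
  ... | false | true = trans (sym e) (all-intro f xs λ a∈ →
                         let (b , b∈ , fa≡gb) = forth a∈ in trans fa≡gb (all-elim g e' b∈))
  ... | true | false = trans (sym (all-intro g ys λ b∈ →
                         let (a , a∈ , fa≡gb) = back b∈ in trans (sym fa≡gb) (all-elim f e a∈))) e'

_==_ : Fin n → Fin n → Bool
zero == zero = true
zero == suc _ = false
suc _ == zero = false
suc x == suc y = x == y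

==-refl : (x : Fin n) → (x == x) ≡ true
==-refl zero = refl
==-refl (suc x) = ==-refl x

==⇒≡ : {x y : Fin n} → (x == y) ≡ true → x ≡ y
==⇒≡ {x = zero} {zero} _ = refl
==⇒≡ {x = suc x} {suc y} e = cong suc (==⇒≡ e)

⌊⌋-true : (d : Dec A) → A → ⌊ d ⌋ ≡ true
⌊⌋-true d a = trans (isYes≗does d) (dec-true d a)

⌊⌋-true⁻ : (d : Dec A) → ⌊ d ⌋ ≡ true → A
⌊⌋-true⁻ (yes a) _ = a

⌊⌋-false : (d : Dec A) → ¬ A → ⌊ d ⌋ ≡ false
⌊⌋-false d ¬a = trans (isYes≗does d) (dec-false d ¬a)

<?-irrefl : (i : Fin n) → ⌊ i <? i ⌋ ≡ false
<?-irrefl i = ⌊⌋-false (i <? i) (Fin.<-irrefl refl)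

≟-via-<? : (i j : Fin n) → ⌊ i ≟ j ⌋ ≡ not ⌊ i <? j ⌋ ∧ not ⌊ j <? i ⌋
≟-via-<? i j with Fin.<-cmp i j
... | tri< i<j i≢j _ rewrite ⌊⌋-false (i ≟ j) i≢j | ⌊⌋-true (i <? j) i<j = refl
... | tri≈ _ refl _ rewrite ⌊⌋-true (i ≟ i) refl | <?-irrefl i = refl
... | tri> _ i≢j j<i rewrite ⌊⌋-false (i ≟ j) i≢j | ⌊⌋-true (j <? i) j<i = sym (∧-zeroʳ _)

-- Ehrenfeucht–Fraïssé games

Position : List Letter → Set
Position xs = Fin (length xs)

record Interp (k m : ℕ) : Set where
  constructor ⟨_,_,_⟩
  field
    str : List Letter
    ρ   : Fin k → Position str
    σ   : Fin m → Position str → Bool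

open Interp

_▹_ : (𝔞 : Interp k m) → Position (str 𝔞) → Interp (suc k) m
𝔞 ▹ p = ⟨ str 𝔞 , p ∷ᶠ ρ 𝔞 , σ 𝔞 ⟩

_▸_ : (𝔞 : Interp k m) → (Position (str 𝔞) → Bool) → Interp k (suc m)
𝔞 ▸ S = ⟨ str 𝔞 , ρ 𝔞 , S ∷ᶠ σ 𝔞 ⟩

variable
  M : Fin k → Bool
  N : Fin m → Bool
  𝔞 𝔟 : Interp k m

-- M and N mark the live variables; dead ones may hold arbitrary values. This is how
-- vacuous quantifiers, and in Split the variables lying in the common suffix, are ignored.
record Agree (M : Fin k → Bool) (N : Fin m → Bool) (𝔞 𝔟 : Interp k m) : Set where
  field
    order  : ∀ x y → M x ≡ true → M y ≡ true →
             ⌊ ρ 𝔞 x <? ρ 𝔞 y ⌋ ≡ ⌊ ρ 𝔟 x <? ρ 𝔟 y ⌋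
    letter : ∀ x → M x ≡ true → lookup (str 𝔞) (ρ 𝔞 x) ≡ lookup (str 𝔟) (ρ 𝔟 x)
    member : ∀ U x → N U ≡ true → M x ≡ true → σ 𝔞 U (ρ 𝔞 x) ≡ σ 𝔟 U (ρ 𝔟 x)

mutual
  data EF (L : Logic) : ℕ → (Fin k → Bool) → (Fin m → Bool) → Interp k m → Interp k m → Set where
    agree  : Agree M N 𝔞 𝔟 → EF L zero M N 𝔞 𝔟
    rounds : Agree M N 𝔞 𝔟 →
             (∀ a → ∃ λ b → EF L q (true ∷ᶠ M) N (𝔞 ▹ a) (𝔟 ▹ b)) →
             (∀ b → ∃ λ a → EF L q (true ∷ᶠ M) N (𝔞 ▹ a) (𝔟 ▹ b)) →
             SetMoves L q M N 𝔞 𝔟 → EF L (suc q) M N 𝔞 𝔟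

  data SetMoves : Logic → ℕ → (Fin k → Bool) → (Fin m → Bool) → Interp k m → Interp k m → Set where
    none : SetMoves fo q M N 𝔞 𝔟
    sets : (∀ S → ∃ λ S' → EF mso q M (true ∷ᶠ N) (𝔞 ▸ S) (𝔟 ▸ S')) →
           (∀ S' → ∃ λ S → EF mso q M (true ∷ᶠ N) (𝔞 ▸ S) (𝔟 ▸ S')) →
           SetMoves mso q M N 𝔞 𝔟

EF-agree : EF L q M N 𝔞 𝔟 → Agree M N 𝔞 𝔟
EF-agree (agree ag) = ag
EF-agree (rounds ag _ _ _) = ag

Agree-sym : Agree M N 𝔞 𝔟 → Agree M N 𝔟 𝔞
Agree-sym ag = record
  { order  = λ x y Mx My → sym (order x y Mx My)
  ; letter = λ x Mx → sym (letter x Mx)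
  ; member = λ U x NU Mx → sym (member U x NU Mx) }
  where open Agree ag

mutual
  EF-sym : EF L q M N 𝔞 𝔟 → EF L q M N 𝔟 𝔞
  EF-sym (agree ag) = agree (Agree-sym ag)
  EF-sym (rounds ag forth back moves) =
    rounds (Agree-sym ag)
      (λ b → let (a , g) = back b in a , EF-sym g)
      (λ a → let (b , g) = forth a in b , EF-sym g)
      (SetMoves-sym moves)

  SetMoves-sym : SetMoves L q M N 𝔞 𝔟 → SetMoves L q M N 𝔟 𝔞
  SetMoves-sym none = none
  SetMoves-sym (sets forth back) =
    sets (λ S' → let (S , g) = back S' in S , EF-sym g)
         (λ S → let (S' , g) = forth S in S' , EF-sym g)

mutual
  EF-lower : EF L (suc q) M N 𝔞 𝔟 → EF L q M N 𝔞 𝔟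
  EF-lower {q = zero} (rounds ag _ _ _) = agree ag
  EF-lower {q = suc q} (rounds ag forth back moves) =
    rounds ag (λ a → let (b , g) = forth a in b , EF-lower g)
              (λ b → let (a , g) = back b in a , EF-lower g)
              (SetMoves-lower moves)

  SetMoves-lower : SetMoves L (suc q) M N 𝔞 𝔟 → SetMoves L q M N 𝔞 𝔟
  SetMoves-lower none = none
  SetMoves-lower (sets forth back) =
    sets (λ S → let (S' , g) = forth S in S' , EF-lower g)
         (λ S' → let (S , g) = back S' in S , EF-lower g)

module _ {xs xs' : List Letter} where

  record Inherits (M₂ : Fin k₂ → Bool) (N₂ : Fin m₂ → Bool)
                  (τ : Fin k₂ → Position xs) (τ' : Fin k₂ → Position xs')
                  (θ : Fin m₂ → Position xs → Bool) (θ' : Fin m₂ → Position xs' → Bool)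
                  (M : Fin k → Bool) (N : Fin m → Bool)
                  (ρ₀ : Fin k → Position xs) (ρ₀' : Fin k → Position xs')
                  (σ₀ : Fin m → Position xs → Bool) (σ₀' : Fin m → Position xs' → Bool) : Set where
    field
      var : ∀ y → M₂ y ≡ true → ∃ λ x → M x ≡ true × τ y ≡ ρ₀ x × τ' y ≡ ρ₀' x
      set : ∀ V → N₂ V ≡ true →
            ∃ λ U → N U ≡ true × (∀ p → θ V p ≡ σ₀ U p) × (∀ p → θ' V p ≡ σ₀' U p)

  variable
    M₂ : Fin k₂ → Bool
    N₂ : Fin m₂ → Bool
    ρ₀ τ : Fin k → Position xs
    ρ₀' τ' : Fin k → Position xs'
    σ₀ θ : Fin m → Position xs → Bool
    σ₀' θ' : Fin m → Position xs' → Bool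

  Inherits-▹ : ∀ a b → Inherits M₂ N₂ τ τ' θ θ' M N ρ₀ ρ₀' σ₀ σ₀' →
               Inherits (true ∷ᶠ M₂) N₂ (a ∷ᶠ τ) (b ∷ᶠ τ') θ θ'
                        (true ∷ᶠ M) N (a ∷ᶠ ρ₀) (b ∷ᶠ ρ₀') σ₀ σ₀'
  Inherits-▹ a b inh = record
    { var = λ { zero _ → zero , refl , refl , refl
              ; (suc y) live → let (x , rest) = Inherits.var inh y live in suc x , rest }
    ; set = Inherits.set inh }

  Inherits-▸ : ∀ S S' → Inherits M₂ N₂ τ τ' θ θ' M N ρ₀ ρ₀' σ₀ σ₀' →
               Inherits M₂ (true ∷ᶠ N₂) τ τ' (S ∷ᶠ θ) (S' ∷ᶠ θ')
                        M (true ∷ᶠ N) ρ₀ ρ₀' (S ∷ᶠ σ₀) (S' ∷ᶠ σ₀')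
  Inherits-▸ S S' inh = record
    { var = Inherits.var inh
    ; set = λ { zero _ → zero , refl , (λ _ → refl) , (λ _ → refl)
              ; (suc V) live → let (U , rest) = Inherits.set inh V live in suc U , rest } }

  Agree-inherit : Inherits M₂ N₂ τ τ' θ θ' M N ρ₀ ρ₀' σ₀ σ₀' →
                  Agree M N ⟨ xs , ρ₀ , σ₀ ⟩ ⟨ xs' , ρ₀' , σ₀' ⟩ →
                  Agree M₂ N₂ ⟨ xs , τ , θ ⟩ ⟨ xs' , τ' , θ' ⟩
  Agree-inherit {τ = τ} {τ'} {θ} {θ'} {ρ₀ = ρ₀} {ρ₀'} {σ₀} {σ₀'} inh ag = record
    { order = λ y₁ y₂ l₁ l₂ →
        let (x₁ , m₁ , e₁ , e₁') = var y₁ l₁ ; (x₂ , m₂ , e₂ , e₂') = var y₂ l₂ in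
        begin
          ⌊ τ y₁ <? τ y₂ ⌋        ≡⟨ cong₂ (λ i j → ⌊ i <? j ⌋) e₁ e₂ ⟩
          ⌊ ρ₀ x₁ <? ρ₀ x₂ ⌋      ≡⟨ Agree.order ag x₁ x₂ m₁ m₂ ⟩
          ⌊ ρ₀' x₁ <? ρ₀' x₂ ⌋    ≡⟨ cong₂ (λ i j → ⌊ i <? j ⌋) e₁' e₂' ⟨
          ⌊ τ' y₁ <? τ' y₂ ⌋      ∎
    ; letter = λ y l →
        let (x , m , e , e') = var y l in
        begin
          lookup xs (τ y)         ≡⟨ cong (lookup xs) e ⟩
          lookup xs (ρ₀ x)        ≡⟨ Agree.letter ag x m ⟩
          lookup xs' (ρ₀' x)      ≡⟨ cong (lookup xs') e' ⟨
          lookup xs' (τ' y)       ∎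
    ; member = λ V y lV ly →
        let (x , m , e , e') = var y ly ; (U , mU , s , s') = set V lV in
        begin
          θ V (τ y)               ≡⟨ s (τ y) ⟩
          σ₀ U (τ y)              ≡⟨ cong (σ₀ U) e ⟩
          σ₀ U (ρ₀ x)             ≡⟨ Agree.member ag U x mU m ⟩
          σ₀' U (ρ₀' x)           ≡⟨ cong (σ₀' U) e' ⟨
          σ₀' U (τ' y)            ≡⟨ s' (τ' y) ⟨
          θ' V (τ' y)             ∎ }
    where
    open Inherits inh
    open ≡-Reasoning

  mutual
    EF-inherit : Inherits M₂ N₂ τ τ' θ θ' M N ρ₀ ρ₀' σ₀ σ₀' →
                 EF L q M N ⟨ xs , ρ₀ , σ₀ ⟩ ⟨ xs' , ρ₀' , σ₀' ⟩ →
                 EF L q M₂ N₂ ⟨ xs , τ , θ ⟩ ⟨ xs' , τ' , θ' ⟩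
    EF-inherit inh (agree ag) = agree (Agree-inherit inh ag)
    EF-inherit inh (rounds ag forth back moves) =
      rounds (Agree-inherit inh ag)
        (λ a → let (b , g) = forth a in b , EF-inherit (Inherits-▹ a b inh) g)
        (λ b → let (a , g) = back b in a , EF-inherit (Inherits-▹ a b inh) g)
        (SetMoves-inherit inh moves)

    SetMoves-inherit : Inherits M₂ N₂ τ τ' θ θ' M N ρ₀ ρ₀' σ₀ σ₀' →
                       SetMoves L q M N ⟨ xs , ρ₀ , σ₀ ⟩ ⟨ xs' , ρ₀' , σ₀' ⟩ →
                       SetMoves L q M₂ N₂ ⟨ xs , τ , θ ⟩ ⟨ xs' , τ' , θ' ⟩
    SetMoves-inherit inh none = none
    SetMoves-inherit inh (sets forth back) =
      sets (λ S → let (S' , g) = forth S in S' , EF-inherit (Inherits-▸ S S' inh) g)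
           (λ S' → let (S , g) = back S' in S , EF-inherit (Inherits-▸ S S' inh) g)

EF-dead-var : ∀ a b → EF L q M N 𝔞 𝔟 → EF L q (false ∷ᶠ M) N (𝔞 ▹ a) (𝔟 ▹ b)
EF-dead-var a b = EF-inherit record
  { var = λ { (suc y) live → y , live , refl , refl }
  ; set = λ V live → V , live , (λ _ → refl) , (λ _ → refl) }

EF-dead-set : ∀ S S' → EF L q M N 𝔞 𝔟 → EF L q M (false ∷ᶠ N) (𝔞 ▸ S) (𝔟 ▸ S')
EF-dead-set S S' = EF-inherit record
  { var = λ y live → y , live , refl , refl
  ; set = λ { (suc V) live → V , live , (λ _ → refl) , (λ _ → refl) } }

EF-≗-set : ∀ {S S' T T'} → (∀ p → T p ≡ S p) → (∀ p → T' p ≡ S' p) →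
           EF L q M (true ∷ᶠ N) (𝔞 ▸ S) (𝔟 ▸ S') → EF L q M (true ∷ᶠ N) (𝔞 ▸ T) (𝔟 ▸ T')
EF-≗-set T≗S T'≗S' = EF-inherit record
  { var = λ y live → y , live , refl , refl
  ; set = λ { zero _ → zero , refl , T≗S , T'≗S'
            ; (suc V) live → suc V , live , (λ _ → refl) , (λ _ → refl) } }

Agree-forget : ∀ {a b} → Agree (true ∷ᶠ M) N (𝔞 ▹ a) (𝔟 ▹ b) → Agree M N 𝔞 𝔟
Agree-forget = Agree-inherit record
  { var = λ y live → suc y , live , refl , refl
  ; set = λ V live → V , live , (λ _ → refl) , (λ _ → refl) }

-- Games decide sentences of bounded rank

subsets-complete : ∀ n (S : Fin n → Bool) → ∃ λ S₀ → S₀ ∈ subsets n × (∀ p → S p ≡ S₀ p)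
subsets-complete zero S = _ , here refl , λ ()
subsets-complete (suc n) S with subsets-complete n (S ∘ suc) | S zero in S0
... | S₀ , S₀∈ , S≗S₀ | true =
  true ∷ᶠ S₀ , ∈-++⁺ˡ (∈-map⁺ (true ∷ᶠ_) S₀∈) , λ { zero → S0 ; (suc p) → S≗S₀ p }
... | S₀ , S₀∈ , S≗S₀ | false =
  false ∷ᶠ S₀ , ∈-++⁺ʳ _ (∈-map⁺ (false ∷ᶠ_) S₀∈) , λ { zero → S0 ; (suc p) → S≗S₀ p }

fromBool : Bool → ℕ
fromBool true = 1
fromBool false = 0

occurs : Formula L k m → Fin k → Bool
occurs (lt x y) z = (z == x) ∨ (z == y)
occurs (eq x y) z = (z == x) ∨ (z == y)
occurs (Pl x) z = z == x
occurs (Pr x) z = z == x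
occurs (mem U x) z = z == x
occurs (neg φ) z = occurs φ z
occurs (and φ ψ) z = occurs φ z ∨ occurs ψ z
occurs (or φ ψ) z = occurs φ z ∨ occurs ψ z
occurs (ex1 φ) z = occurs φ (suc z)
occurs (all1 φ) z = occurs φ (suc z)
occurs (ex2 φ) z = occurs φ z
occurs (all2 φ) z = occurs φ z

occursSet : Formula L k m → Fin m → Bool
occursSet (lt x y) V = false
occursSet (eq x y) V = false
occursSet (Pl x) V = false
occursSet (Pr x) V = false
occursSet (mem U x) V = V == U
occursSet (neg φ) V = occursSet φ V
occursSet (and φ ψ) V = occursSet φ V ∨ occursSet ψ V
occursSet (or φ ψ) V = occursSet φ V ∨ occursSet ψ V
occursSet (ex1 φ) V = occursSet φ V
occursSet (all1 φ) V = occursSet φ V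
occursSet (ex2 φ) V = occursSet φ (suc V)
occursSet (all2 φ) V = occursSet φ (suc V)

-- Quantifiers whose variable does not occur are not counted; with this
-- convention 2 · rank ≤ size + 1 holds for sentences.
rank : Formula L k m → ℕ
rank (lt x y) = 0
rank (eq x y) = 0
rank (Pl x) = 0
rank (Pr x) = 0
rank (mem U x) = 0
rank (neg φ) = rank φ
rank (and φ ψ) = rank φ ⊔ rank ψ
rank (or φ ψ) = rank φ ⊔ rank ψ
rank (ex1 φ) = fromBool (occurs φ zero) + rank φ
rank (all1 φ) = fromBool (occurs φ zero) + rank φ
rank (ex2 φ) = fromBool (occursSet φ zero) + rank φ
rank (all2 φ) = fromBool (occursSet φ zero) + rank φ

_⊆ᵇ_ : (Fin n → Bool) → (Fin n → Bool) → Set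
P ⊆ᵇ Q = ∀ x → P x ≡ true → Q x ≡ true

∨-⊆ᵇˡ : ∀ {P Q R : Fin n → Bool} → (λ x → P x ∨ Q x) ⊆ᵇ R → P ⊆ᵇ R
∨-⊆ᵇˡ h x Px = h x (subst (λ b → b ∨ _ ≡ true) (sym Px) refl)

∨-⊆ᵇʳ : ∀ {P Q R : Fin n → Bool} → (λ x → P x ∨ Q x) ⊆ᵇ R → Q ⊆ᵇ R
∨-⊆ᵇʳ {P = P} h x Qx = h x (subst (λ b → P x ∨ b ≡ true) (sym Qx) (∨-zeroʳ (P x)))

⊆ᵇ-∷ : ∀ {P : Fin (suc n) → Bool} {b Q} →
       (P zero ≡ true → b ≡ true) → (P ∘ suc) ⊆ᵇ Q → P ⊆ᵇ (b ∷ᶠ Q)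
⊆ᵇ-∷ h _ zero = h
⊆ᵇ-∷ _ h (suc x) = h x

==-reflˡ : (x : Fin n) (b : Bool) → (x == x) ∨ b ≡ true
==-reflˡ x b rewrite ==-refl x = refl

==-reflʳ : (a : Bool) (y : Fin n) → a ∨ (y == y) ≡ true
==-reflʳ a y rewrite ==-refl y = ∨-zeroʳ a

variable
  w w' : Word

mutual
  EF⇒eval≡ : ∀ {ρ ρ' σ σ'} (φ : Formula L k m) →
             occurs φ ⊆ᵇ M → occursSet φ ⊆ᵇ N → rank φ ≤ q →
             EF L q M N ⟨ toList w , ρ , σ ⟩ ⟨ toList w' , ρ' , σ' ⟩ →
             eval w ρ σ φ ≡ eval w' ρ' σ' φ
  EF⇒eval≡ (lt x y) cov _ _ g =
    Agree.order (EF-agree g) x y (cov x (==-reflˡ x _)) (cov y (==-reflʳ _ y))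
  EF⇒eval≡ {ρ = ρ} {ρ'} (eq x y) cov _ _ g
    rewrite ≟-via-<? (ρ x) (ρ y) | ≟-via-<? (ρ' x) (ρ' y)
          | Agree.order (EF-agree g) x y (cov x (==-reflˡ x _)) (cov y (==-reflʳ _ y))
          | Agree.order (EF-agree g) y x (cov y (==-reflʳ _ y)) (cov x (==-reflˡ x _)) = refl
  EF⇒eval≡ (Pl x) cov _ _ g = cong isL (Agree.letter (EF-agree g) x (cov x (==-refl x)))
  EF⇒eval≡ (Pr x) cov _ _ g = cong isR (Agree.letter (EF-agree g) x (cov x (==-refl x)))
  EF⇒eval≡ (mem U x) cov covS _ g = Agree.member (EF-agree g) U x (covS U (==-refl U)) (cov x (==-refl x))
  EF⇒eval≡ (neg φ) cov covS rk g = cong not (EF⇒eval≡ φ cov covS rk g)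
  EF⇒eval≡ (and φ ψ) cov covS rk g =
    cong₂ _∧_ (EF⇒eval≡ φ (∨-⊆ᵇˡ cov) (∨-⊆ᵇˡ covS) (m⊔n≤o⇒m≤o _ _ rk) g)
              (EF⇒eval≡ ψ (∨-⊆ᵇʳ cov) (∨-⊆ᵇʳ covS) (m⊔n≤o⇒n≤o _ _ rk) g)
  EF⇒eval≡ (or φ ψ) cov covS rk g =
    cong₂ _∨_ (EF⇒eval≡ φ (∨-⊆ᵇˡ cov) (∨-⊆ᵇˡ covS) (m⊔n≤o⇒m≤o _ _ rk) g)
              (EF⇒eval≡ ψ (∨-⊆ᵇʳ cov) (∨-⊆ᵇʳ covS) (m⊔n≤o⇒n≤o _ _ rk) g)
  EF⇒eval≡ (ex1 φ) cov covS rk g = any-cong (point-image φ cov covS rk g)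
  EF⇒eval≡ (all1 φ) cov covS rk g = all-cong (point-image φ cov covS rk g)
  EF⇒eval≡ (ex2 φ) cov covS rk g = any-cong (set-image φ cov covS rk g)
  EF⇒eval≡ (all2 φ) cov covS rk g = all-cong (set-image φ cov covS rk g)

  point-image : ∀ {ρ ρ' σ σ'} (φ : Formula L (suc k) m) →
                (occurs φ ∘ suc) ⊆ᵇ M → occursSet φ ⊆ᵇ N → fromBool (occurs φ zero) + rank φ ≤ q →
                EF L q M N ⟨ toList w , ρ , σ ⟩ ⟨ toList w' , ρ' , σ' ⟩ →
                SameImage (λ a → eval w (a ∷ᶠ ρ) σ φ) (allFin ∣ w ∣)
                          (λ b → eval w' (b ∷ᶠ ρ') σ' φ) (allFin ∣ w' ∣)
  point-image φ cov covS rk g = record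
    { forth = λ {a} _ → point-response φ cov covS rk g a
    ; back  = λ {b} _ → let (a , a∈ , e) = point-response φ cov covS rk (EF-sym g) b in a , a∈ , sym e }

  point-response : ∀ {ρ ρ' σ σ'} (φ : Formula L (suc k) m) →
                   (occurs φ ∘ suc) ⊆ᵇ M → occursSet φ ⊆ᵇ N → fromBool (occurs φ zero) + rank φ ≤ q →
                   EF L q M N ⟨ toList w , ρ , σ ⟩ ⟨ toList w' , ρ' , σ' ⟩ →
                   ∀ a → ∃ λ b → b ∈ allFin ∣ w' ∣ ×
                                 eval w (a ∷ᶠ ρ) σ φ ≡ eval w' (b ∷ᶠ ρ') σ' φ
  point-response φ cov covS rk g a with occurs φ zero in live
  point-response φ cov covS (s≤s rk) (rounds _ forth _ _) a | true =
    let (b , g') = forth a in b , ∈-allFin b , EF⇒eval≡ φ (⊆ᵇ-∷ (λ _ → refl) cov) covS rk g'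
  ... | false =
    zero , here refl , EF⇒eval≡ φ (⊆ᵇ-∷ (trans (sym live)) cov) covS rk (EF-dead-var a zero g)

  set-image : ∀ {ρ ρ' σ σ'} (φ : Formula mso k (suc m)) →
              occurs φ ⊆ᵇ M → (occursSet φ ∘ suc) ⊆ᵇ N → fromBool (occursSet φ zero) + rank φ ≤ q →
              EF mso q M N ⟨ toList w , ρ , σ ⟩ ⟨ toList w' , ρ' , σ' ⟩ →
              SameImage (λ S → eval w ρ (S ∷ᶠ σ) φ) (subsets ∣ w ∣)
                        (λ S' → eval w' ρ' (S' ∷ᶠ σ') φ) (subsets ∣ w' ∣)
  set-image φ cov covS rk g = record
    { forth = λ {S} _ → set-response φ cov covS rk g S
    ; back  = λ {S'} _ → let (S , S∈ , e) = set-response φ cov covS rk (EF-sym g) S' in S , S∈ , sym e }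

  set-response : ∀ {ρ ρ' σ σ'} (φ : Formula mso k (suc m)) →
                 occurs φ ⊆ᵇ M → (occursSet φ ∘ suc) ⊆ᵇ N → fromBool (occursSet φ zero) + rank φ ≤ q →
                 EF mso q M N ⟨ toList w , ρ , σ ⟩ ⟨ toList w' , ρ' , σ' ⟩ →
                 ∀ S → ∃ λ S' → S' ∈ subsets ∣ w' ∣ ×
                                eval w ρ (S ∷ᶠ σ) φ ≡ eval w' ρ' (S' ∷ᶠ σ') φ
  set-response φ cov covS rk g S with occursSet φ zero in live
  set-response φ cov covS (s≤s rk) (rounds _ _ _ (sets forth _)) S | true =
    let (S' , g') = forth S ; (S₀ , S₀∈ , S'≗S₀) = subsets-complete _ S' in
    S₀ , S₀∈ ,
    EF⇒eval≡ φ cov (⊆ᵇ-∷ (λ _ → refl) covS) rk (EF-≗-set (λ _ → refl) (sym ∘ S'≗S₀) g')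
  ... | false =
    let (S₀ , S₀∈ , _) = subsets-complete _ (λ _ → false) in
    S₀ , S₀∈ , EF⇒eval≡ φ cov (⊆ᵇ-∷ (trans (sym live)) covS) rk (EF-dead-set S S₀ g)

-- Rank versus size

countTrue : (Fin n → Bool) → ℕ
countTrue {zero} P = 0
countTrue {suc n} P = fromBool (P zero) + countTrue (P ∘ suc)

fromBool-∨ : ∀ a b → fromBool (a ∨ b) ≤ fromBool a + fromBool b
fromBool-∨ true b = s≤s z≤n
fromBool-∨ false b = ≤-refl

fromBool≤1 : ∀ a → fromBool a ≤ 1
fromBool≤1 true = ≤-refl
fromBool≤1 false = z≤n

countTrue-∨ : (P Q : Fin n → Bool) → countTrue (λ x → P x ∨ Q x) ≤ countTrue P + countTrue Q
countTrue-∨ {zero} P Q = z≤n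
countTrue-∨ {suc n} P Q = begin
  fromBool (P zero ∨ Q zero) + countTrue (λ x → P (suc x) ∨ Q (suc x))
    ≤⟨ +-mono-≤ (fromBool-∨ (P zero) (Q zero)) (countTrue-∨ (P ∘ suc) (Q ∘ suc)) ⟩
  (fromBool (P zero) + fromBool (Q zero)) + (countTrue (P ∘ suc) + countTrue (Q ∘ suc))
    ≡⟨ +-interchange (fromBool (P zero)) (fromBool (Q zero)) (countTrue (P ∘ suc)) (countTrue (Q ∘ suc)) ⟩
  countTrue P + countTrue Q ∎
  where open ≤-Reasoning

countTrue-false : countTrue {n} (λ _ → false) ≡ 0
countTrue-false {zero} = refl
countTrue-false {suc n} = countTrue-false {n}

countTrue-== : (y : Fin n) → countTrue (_== y) ≤ 1
countTrue-== {suc n} zero = ≤-reflexive (cong suc (countTrue-false {n}))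
countTrue-== (suc y) = countTrue-== y

freeCount : Formula L k m → ℕ
freeCount φ = countTrue (occurs φ) + countTrue (occursSet φ)

freeCount-∨ : (φ ψ : Formula L k m) →
              countTrue (λ x → occurs φ x ∨ occurs ψ x) + countTrue (λ V → occursSet φ V ∨ occursSet ψ V)
              ≤ freeCount φ + freeCount ψ
freeCount-∨ φ ψ =
  ≤-trans (+-mono-≤ (countTrue-∨ (occurs φ) (occurs ψ)) (countTrue-∨ (occursSet φ) (occursSet ψ)))
  (≤-reflexive (+-interchange (countTrue (occurs φ)) (countTrue (occurs ψ)) (countTrue (occursSet φ)) _))

binary-arith : ∀ r₁ r₂ {f₁ f₂ f s₁ s₂} →
               f ≤ f₁ + f₂ → 2 * r₁ + f₁ ≤ s₁ + 1 → 2 * r₂ + f₂ ≤ s₂ + 1 →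
               2 * (r₁ ⊔ r₂) + f ≤ (s₁ + s₂ + 1) + 1
binary-arith r₁ r₂ {f₁} {f₂} {f} {s₁} {s₂} f≤ h₁ h₂ = begin
  2 * (r₁ ⊔ r₂) + f                   ≤⟨ +-mono-≤ (*-monoʳ-≤ 2 (m⊔n≤m+n r₁ r₂)) f≤ ⟩
  2 * (r₁ + r₂) + (f₁ + f₂)
    ≡⟨ solve 4 (λ r₁ r₂ f₁ f₂ → con 2 :* (r₁ :+ r₂) :+ (f₁ :+ f₂)
                                 := (con 2 :* r₁ :+ f₁) :+ (con 2 :* r₂ :+ f₂)) refl r₁ r₂ f₁ f₂ ⟩
  (2 * r₁ + f₁) + (2 * r₂ + f₂)       ≤⟨ +-mono-≤ h₁ h₂ ⟩
  (s₁ + 1) + (s₂ + 1)                 ≡⟨ solve 2 (λ s₁ s₂ → (s₁ :+ con 1) :+ (s₂ :+ con 1)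
                                                 := (s₁ :+ s₂ :+ con 1) :+ con 1) refl s₁ s₂ ⟩
  (s₁ + s₂ + 1) + 1                   ∎
  where open ≤-Reasoning

quantifier-arith : ∀ q {b c f s} → b ≤ 1 → f ≡ b + c → 2 * q + f ≤ s + 1 → 2 * (b + q) + c ≤ suc s + 1
quantifier-arith q {b} {c} {f} {s} b≤1 refl h = begin
  2 * (b + q) + c
    ≡⟨ solve 3 (λ b q c → con 2 :* (b :+ q) :+ c := b :+ (con 2 :* q :+ (b :+ c))) refl b q c ⟩
  b + (2 * q + (b + c))   ≤⟨ +-mono-≤ b≤1 h ⟩
  suc s + 1               ∎
  where open ≤-Reasoning

RankFreeCountBound : Formula L k m → Set
RankFreeCountBound φ = 2 * rank φ + freeCount φ ≤ sz φ + 1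

binary-step : (φ ψ : Formula L k m) → RankFreeCountBound φ → RankFreeCountBound ψ → RankFreeCountBound (and φ ψ)
binary-step φ ψ = binary-arith (rank φ) (rank ψ) (freeCount-∨ φ ψ)

point-quantifier-step : (φ : Formula L (suc k) m) → RankFreeCountBound φ → RankFreeCountBound (ex1 φ)
point-quantifier-step φ =
  quantifier-arith (rank φ) (fromBool≤1 (occurs φ zero)) (+-assoc (fromBool (occurs φ zero)) _ _)

set-quantifier-step : (φ : Formula mso k (suc m)) → RankFreeCountBound φ → RankFreeCountBound (ex2 φ)
set-quantifier-step φ =
  quantifier-arith (rank φ) (fromBool≤1 (occursSet φ zero))
                   (+-exchange (countTrue (occurs φ)) (fromBool (occursSet φ zero)) _)

-- An atom has at most two free variables, and a counted quantifier adds one symbol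
-- while turning a free variable into a bound one.
rank-freeCount-bound : (φ : Formula L k m) → RankFreeCountBound φ
rank-freeCount-bound {m = m} (lt x y) = two-vars x y
  where
  two-vars : ∀ {k} (x y : Fin k) → countTrue (λ z → (z == x) ∨ (z == y)) + countTrue {m} (λ _ → false) ≤ 2
  two-vars x y rewrite countTrue-false {m} | +-identityʳ (countTrue (λ z → (z == x) ∨ (z == y))) =
    ≤-trans (countTrue-∨ (_== x) (_== y)) (+-mono-≤ (countTrue-== x) (countTrue-== y))
rank-freeCount-bound {L = L} {m = m} (eq x y) = rank-freeCount-bound {L = L} {m = m} (lt x y)
rank-freeCount-bound {m = m} (Pl x) = +-mono-≤ (countTrue-== x) (m≤n⇒m≤1+n (≤-reflexive (countTrue-false {m})))
rank-freeCount-bound {m = m} (Pr x) = +-mono-≤ (countTrue-== x) (m≤n⇒m≤1+n (≤-reflexive (countTrue-false {m})))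
rank-freeCount-bound (mem U x) = +-mono-≤ (countTrue-== x) (countTrue-== U)
rank-freeCount-bound (neg φ) = m≤n⇒m≤1+n (rank-freeCount-bound φ)
rank-freeCount-bound (and φ ψ) = binary-step φ ψ (rank-freeCount-bound φ) (rank-freeCount-bound ψ)
rank-freeCount-bound (or φ ψ) = binary-step φ ψ (rank-freeCount-bound φ) (rank-freeCount-bound ψ)
rank-freeCount-bound (ex1 φ) = point-quantifier-step φ (rank-freeCount-bound φ)
rank-freeCount-bound (all1 φ) = point-quantifier-step φ (rank-freeCount-bound φ)
rank-freeCount-bound (ex2 φ) = set-quantifier-step φ (rank-freeCount-bound φ)
rank-freeCount-bound (all2 φ) = set-quantifier-step φ (rank-freeCount-bound φ)

rank-bound : (φ : Sentence L) → 2 * rank φ ≤ sz φ + 1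
rank-bound φ = ≤-trans (≤-reflexive (sym (+-identityʳ _))) (rank-freeCount-bound φ)

rank≤ceilHalf : (φ : Sentence L) → sz φ ≤ n → rank φ ≤ ceilHalf n
rank≤ceilHalf {n = n} φ sz≤n = begin
  rank φ               ≡⟨ m*n/n≡m (rank φ) 2 ⟨
  rank φ * 2 / 2       ≤⟨ /-monoˡ-≤ 2 (≤-trans (≤-reflexive (*-comm (rank φ) 2))
                                            (≤-trans (rank-bound φ) (+-monoˡ-≤ 1 sz≤n))) ⟩
  (n + 1) / 2          ∎
  where open ≤-Reasoning

-- Rank-q types

bitFin : Bool → Fin 2
bitFin false = zero
bitFin true = suc zero

bitFin-injective : ∀ {a b} → bitFin a ≡ bitFin b → a ≡ b
bitFin-injective {false} {false} _ = refl
bitFin-injective {true} {true} _ = refl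

funToFin-injective : (f g : Fin m → Fin n) → funToFin f ≡ funToFin g → ∀ i → f i ≡ g i
funToFin-injective f g e i = begin
  f i                       ≡⟨ finToFun-funToFin f i ⟨
  finToFun (funToFin f) i   ≡⟨ cong (λ c → finToFun c i) e ⟩
  finToFun (funToFin g) i   ≡⟨ finToFun-funToFin g i ⟩
  g i                       ∎
  where open ≡-Reasoning

encodeSet : (Fin n → Bool) → Fin (2 ^ n)
encodeSet S = funToFin (bitFin ∘ S)

encodeSet-injective : {S T : Fin n → Bool} → encodeSet S ≡ encodeSet T → ∀ i → S i ≡ T i
encodeSet-injective {S = S} {T} e i = bitFin-injective (funToFin-injective (bitFin ∘ S) (bitFin ∘ T) e i)

image : (A → Fin n) → List A → Fin n → Bool
image f xs c = any (λ a → ⌊ f a ≟ c ⌋) xs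

image-transfer : (f : A → Fin n) (xs : List A) (g : B → Fin n) (ys : List B) →
                 (∀ c → image f xs c ≡ image g ys c) → ∀ {a} → a ∈ xs → ∃ λ b → b ∈ ys × g b ≡ f a
image-transfer f xs g ys same {a} a∈xs =
  let (b , b∈ys , gb≟fa) =
        any-witness _ ys (trans (sym (same (f a))) (any-intro _ a∈xs (⌊⌋-true (f a ≟ f a) refl)))
  in b , b∈ys , ⌊⌋-true⁻ (g b ≟ f a) gb≟fa

isL-injective : ∀ {a b} → isL a ≡ isL b → a ≡ b
isL-injective {l} {l} _ = refl
isL-injective {r} {r} _ = refl

-- On the diagonal the order is trivially false, so it records the letter instead.
diagram : (𝔞 : Interp k m) → Fin k → Fin k → Bool
diagram 𝔞 x y = if x == y then isL (lookup (str 𝔞) (ρ 𝔞 x)) else ⌊ ρ 𝔞 x <? ρ 𝔞 y ⌋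

atomicCode : (𝔞 : Interp k m) → Fin ((2 ^ k) ^ k * (2 ^ k) ^ m)
atomicCode 𝔞 = combine (funToFin (λ x → encodeSet (diagram 𝔞 x)))
                       (funToFin (λ U → encodeSet (λ x → σ 𝔞 U (ρ 𝔞 x))))

atomicCode-≡⇒Agree : atomicCode 𝔞 ≡ atomicCode 𝔟 → Agree M N 𝔞 𝔟
atomicCode-≡⇒Agree {𝔞 = 𝔞} {𝔟 = 𝔟} e = record
  { order = λ x y _ _ → order x y
  ; letter = λ x _ → letter x
  ; member = λ U x _ _ → encodeSet-injective (funToFin-injective _ _ (proj₂ parts) U) x }
  where
  parts = combine-injective _ _ _ _ e

  diagram-≡ : ∀ x y → diagram 𝔞 x y ≡ diagram 𝔟 x y
  diagram-≡ x = encodeSet-injective (funToFin-injective _ _ (proj₁ parts) x)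

  order : ∀ x y → ⌊ ρ 𝔞 x <? ρ 𝔞 y ⌋ ≡ ⌊ ρ 𝔟 x <? ρ 𝔟 y ⌋
  order x y with x == y in x==y | diagram-≡ x y
  ... | false | d = d
  ... | true | _ with refl ← ==⇒≡ {x = x} {y} x==y = trans (<?-irrefl (ρ 𝔞 x)) (sym (<?-irrefl (ρ 𝔟 x)))

  letter : ∀ x → lookup (str 𝔞) (ρ 𝔞 x) ≡ lookup (str 𝔟) (ρ 𝔟 x)
  letter x with x == x in x==x | diagram-≡ x x
  ... | true | d = isL-injective d
  ... | false | _ with () ← trans (sym (==-refl x)) x==x

-- The size of the code space, not the exact number of rank-q types.
typeCount : Logic → ℕ → ℕ → ℕ → ℕ
typeCount L zero k m = (2 ^ k) ^ k * (2 ^ k) ^ m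
typeCount fo (suc q) k m = 2 ^ typeCount fo q (suc k) m
typeCount mso (suc q) k m = 2 ^ typeCount mso q (suc k) m * 2 ^ typeCount mso q k (suc m)

-- A rank-(q+1) type is the set of rank-q types of the one-point (for MSO also one-set) expansions.
mutual
  typeCode : ∀ L q → Interp k m → Fin (typeCount L q k m)
  typeCode L zero 𝔞 = atomicCode 𝔞
  typeCode fo (suc q) 𝔞 = encodeSet (pointTypes fo q 𝔞)
  typeCode mso (suc q) 𝔞 = combine (encodeSet (pointTypes mso q 𝔞)) (encodeSet (setTypes q 𝔞))

  pointTypes : ∀ L q → (𝔞 : Interp k m) → Fin (typeCount L q (suc k) m) → Bool
  pointTypes L q 𝔞 = image (λ a → typeCode L q (𝔞 ▹ a)) (allFin _)

  setTypes : ∀ q → (𝔞 : Interp k m) → Fin (typeCount mso q k (suc m)) → Bool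
  setTypes q 𝔞 = image (λ S → typeCode mso q (𝔞 ▸ S)) (subsets _)

pointTypes-≡ : ∀ L q (𝔞 𝔟 : Interp k m) → typeCode L (suc q) 𝔞 ≡ typeCode L (suc q) 𝔟 →
               ∀ c → pointTypes L q 𝔞 c ≡ pointTypes L q 𝔟 c
pointTypes-≡ fo q 𝔞 𝔟 e = encodeSet-injective e
pointTypes-≡ mso q 𝔞 𝔟 e =
  encodeSet-injective (proj₁ (combine-injective _ (encodeSet (setTypes q 𝔞)) _ (encodeSet (setTypes q 𝔟)) e))

setTypes-≡ : ∀ q (𝔞 𝔟 : Interp k m) → typeCode mso (suc q) 𝔞 ≡ typeCode mso (suc q) 𝔟 →
             ∀ c → setTypes q 𝔞 c ≡ setTypes q 𝔟 c
setTypes-≡ q 𝔞 𝔟 e =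
  encodeSet-injective
    (proj₂ (combine-injective (encodeSet (pointTypes mso q 𝔞)) _ (encodeSet (pointTypes mso q 𝔟)) _ e))

-- The positions are needed because agreement at positive rank is read off a forth move.
mutual
  typeCode-≡⇒EF : ∀ L q (𝔞 𝔟 : Interp k m) → Position (str 𝔞) → Position (str 𝔟) →
                  typeCode L q 𝔞 ≡ typeCode L q 𝔟 → EF L q M N 𝔞 𝔟
  typeCode-≡⇒EF L zero 𝔞 𝔟 _ _ e = agree (atomicCode-≡⇒Agree e)
  typeCode-≡⇒EF L (suc q) 𝔞 𝔟 p p' e =
    rounds (Agree-forget (EF-agree (proj₂ (typeCode-point-forth L q 𝔞 𝔟 p p' e p))))
           (typeCode-point-forth L q 𝔞 𝔟 p p' e)
           (λ b → let (a , g) = typeCode-point-forth L q 𝔟 𝔞 p' p (sym e) b in a , EF-sym g)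
           (typeCode-set-moves L q 𝔞 𝔟 p p' e)

  typeCode-point-forth : ∀ L q (𝔞 𝔟 : Interp k m) → Position (str 𝔞) → Position (str 𝔟) →
                typeCode L (suc q) 𝔞 ≡ typeCode L (suc q) 𝔟 →
                ∀ a → ∃ λ b → EF L q (true ∷ᶠ M) N (𝔞 ▹ a) (𝔟 ▹ b)
  typeCode-point-forth L q 𝔞 𝔟 p p' e a =
    let (b , _ , same) = image-transfer _ _ (λ b → typeCode L q (𝔟 ▹ b)) (allFin _)
                                        (pointTypes-≡ L q 𝔞 𝔟 e) (∈-allFin a) in
    b , typeCode-≡⇒EF L q (𝔞 ▹ a) (𝔟 ▹ b) p p' (sym same)

  typeCode-set-moves : ∀ L q (𝔞 𝔟 : Interp k m) → Position (str 𝔞) → Position (str 𝔟) →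
              typeCode L (suc q) 𝔞 ≡ typeCode L (suc q) 𝔟 → SetMoves L q M N 𝔞 𝔟
  typeCode-set-moves fo q 𝔞 𝔟 p p' e = none
  typeCode-set-moves mso q 𝔞 𝔟 p p' e =
    sets (typeCode-set-forth q 𝔞 𝔟 p p' e)
         (λ S' → let (S , g) = typeCode-set-forth q 𝔟 𝔞 p' p (sym e) S' in S , EF-sym g)

  typeCode-set-forth : ∀ q (𝔞 𝔟 : Interp k m) → Position (str 𝔞) → Position (str 𝔟) →
              typeCode mso (suc q) 𝔞 ≡ typeCode mso (suc q) 𝔟 →
              ∀ S → ∃ λ S' → EF mso q M (true ∷ᶠ N) (𝔞 ▸ S) (𝔟 ▸ S')
  typeCode-set-forth q 𝔞 𝔟 p p' e S =
    let (S₀ , S₀∈ , S≗S₀) = subsets-complete _ S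
        (S' , _ , same) = image-transfer _ _ (λ S' → typeCode mso q (𝔟 ▸ S')) (subsets _)
                                         (setTypes-≡ q 𝔞 𝔟 e) S₀∈ in
    S' , EF-≗-set S≗S₀ (λ _ → refl) (typeCode-≡⇒EF mso q (𝔞 ▸ S₀) (𝔟 ▸ S') p p' (sym same))

-- Appending a common suffix

variable
  us us' zs : List Letter

posˡ : ∀ us {zs} → Position us → Position (us ++ zs)
posˡ (_ ∷ us) zero = zero
posˡ (_ ∷ us) (suc i) = suc (posˡ us i)

posʳ : ∀ us {zs} → Position zs → Position (us ++ zs)
posʳ [] j = j
posʳ (_ ∷ us) j = suc (posʳ us j)

position-++ : ∀ us {zs} (p : Position (us ++ zs)) →
              (∃ λ i → p ≡ posˡ us i) ⊎ (∃ λ j → p ≡ posʳ us j)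
position-++ [] p = inj₂ (p , refl)
position-++ (_ ∷ us) zero = inj₁ (zero , refl)
position-++ (_ ∷ us) (suc p) with position-++ us p
... | inj₁ (i , e) = inj₁ (suc i , cong suc e)
... | inj₂ (j , e) = inj₂ (j , cong suc e)

toℕ-posˡ : ∀ us {zs} (i : Position us) → toℕ (posˡ us {zs} i) ≡ toℕ i
toℕ-posˡ (_ ∷ us) zero = refl
toℕ-posˡ (_ ∷ us) (suc i) = cong suc (toℕ-posˡ us i)

toℕ-posʳ : ∀ us {zs} (j : Position zs) → toℕ (posʳ us {zs} j) ≡ length us + toℕ j
toℕ-posʳ [] j = refl
toℕ-posʳ (_ ∷ us) {zs} j = cong suc (toℕ-posʳ us {zs} j)

lookup-posˡ : ∀ us {zs} (i : Position us) → lookup (us ++ zs) (posˡ us i) ≡ lookup us i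
lookup-posˡ (_ ∷ us) zero = refl
lookup-posˡ (_ ∷ us) (suc i) = lookup-posˡ us i

lookup-posʳ : ∀ us {zs} (j : Position zs) → lookup (us ++ zs) (posʳ us {zs} j) ≡ lookup zs j
lookup-posʳ [] j = refl
lookup-posʳ (_ ∷ us) {zs} j = lookup-posʳ us {zs} j

<?-cong : {i j : Fin n} {i' j' : Fin m} →
          (toℕ i < toℕ j → toℕ i' < toℕ j') → (toℕ i' < toℕ j' → toℕ i < toℕ j) →
          ⌊ i <? j ⌋ ≡ ⌊ i' <? j' ⌋
<?-cong {i = i} {j} {i'} {j'} to from with i <? j | i' <? j'
... | yes _ | yes _ = refl
... | no _ | no _ = refl
... | yes i<j | no i'≮j' = ⊥-elim (i'≮j' (to i<j))
... | no i≮j | yes i'<j' = ⊥-elim (i≮j (from i'<j'))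

<?-posˡ : ∀ us {zs} (i i' : Position us) → ⌊ posˡ us {zs} i <? posˡ us i' ⌋ ≡ ⌊ i <? i' ⌋
<?-posˡ us i i' = <?-cong (subst₂ _<_ (toℕ-posˡ us i) (toℕ-posˡ us i'))
                           (subst₂ _<_ (sym (toℕ-posˡ us i)) (sym (toℕ-posˡ us i')))

<?-posʳ : ∀ us {zs} (j j' : Position zs) → ⌊ posʳ us {zs} j <? posʳ us j' ⌋ ≡ ⌊ j <? j' ⌋
<?-posʳ us {zs} j j' = <?-cong
  (λ lt → +-cancelˡ-< (length us) _ _ (subst₂ _<_ (toℕ-posʳ us {zs} j) (toℕ-posʳ us {zs} j') lt))
  (λ lt → subst₂ _<_ (sym (toℕ-posʳ us {zs} j)) (sym (toℕ-posʳ us {zs} j')) (+-monoʳ-< (length us) lt))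

posˡ<posʳ : ∀ us {zs} (i : Position us) (j : Position zs) → toℕ (posˡ us {zs} i) < toℕ (posʳ us {zs} j)
posˡ<posʳ us {zs} i j =
  subst₂ _<_ (sym (toℕ-posˡ us i)) (sym (toℕ-posʳ us {zs} j)) (≤-trans (toℕ<n i) (m≤m+n _ _))

<?-posˡʳ : ∀ us {zs} (i : Position us) (j : Position zs) → ⌊ posˡ us i <? posʳ us {zs} j ⌋ ≡ true
<?-posˡʳ us {zs} i j = ⌊⌋-true (posˡ us i <? posʳ us {zs} j) (posˡ<posʳ us {zs} i j)

<?-posʳˡ : ∀ us {zs} (i : Position us) (j : Position zs) → ⌊ posʳ us {zs} j <? posˡ us i ⌋ ≡ false
<?-posʳˡ us {zs} i j = ⌊⌋-false (posʳ us {zs} j <? posˡ us i) (<⇒≯ (posˡ<posʳ us {zs} i j))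

joinSets : ∀ us {zs} → (Position us → Bool) → (Position zs → Bool) → Position (us ++ zs) → Bool
joinSets [] S T = T
joinSets (_ ∷ us) S T zero = S zero
joinSets (_ ∷ us) S T (suc p) = joinSets us (S ∘ suc) T p

joinSets-posˡ : ∀ us {zs} S T (i : Position us) → joinSets us {zs} S T (posˡ us i) ≡ S i
joinSets-posˡ (_ ∷ us) S T zero = refl
joinSets-posˡ (_ ∷ us) S T (suc i) = joinSets-posˡ us (S ∘ suc) T i

joinSets-posʳ : ∀ us {zs} S T (j : Position zs) → joinSets us S T (posʳ us {zs} j) ≡ T j
joinSets-posʳ [] S T j = refl
joinSets-posʳ (_ ∷ us) S T j = joinSets-posʳ us (S ∘ suc) T j

-- The invariant of the composition argument: each variable sits either at the same
-- position of the common suffix zs on both sides, or in the prefixes, where the game on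
-- us against us' is won. Suffix variables are dead there and take the spare positions.
record Split (L : Logic) (q : ℕ) (us us' zs : List Letter)
             (ρ : Fin k → Position (us ++ zs)) (ρ' : Fin k → Position (us' ++ zs))
             (σ : Fin m → Position (us ++ zs) → Bool) (σ' : Fin m → Position (us' ++ zs) → Bool) : Set where
  field
    inPrefix : Fin k → Bool
    ρᵖ       : Fin k → Position us
    ρᵖ'      : Fin k → Position us'
    σᵖ       : Fin m → Position us → Bool
    σᵖ'      : Fin m → Position us' → Bool
    Nᵖ       : Fin m → Bool
    spare    : Position us
    spare'   : Position us'
    all-live : ∀ U → Nᵖ U ≡ true
    prefix-ρ : ∀ x → inPrefix x ≡ true → ρ x ≡ posˡ us (ρᵖ x) × ρ' x ≡ posˡ us' (ρᵖ' x)
    suffix-ρ : ∀ x → inPrefix x ≡ false → ∃ λ j → ρ x ≡ posʳ us j × ρ' x ≡ posʳ us' j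
    prefix-σ : ∀ U i → σ U (posˡ us i) ≡ σᵖ U i
    prefix-σ' : ∀ U i → σ' U (posˡ us' i) ≡ σᵖ' U i
    suffix-σ : ∀ U j → σ U (posʳ us j) ≡ σ' U (posʳ us' j)
    game     : EF L q inPrefix Nᵖ ⟨ us , ρᵖ , σᵖ ⟩ ⟨ us' , ρᵖ' , σᵖ' ⟩

Split-sym : ∀ {ρ ρ' σ σ'} → Split {k} {m} L q us us' zs ρ ρ' σ σ' → Split L q us' us zs ρ' ρ σ' σ
Split-sym sp = record
  { inPrefix = inPrefix ; ρᵖ = ρᵖ' ; ρᵖ' = ρᵖ ; σᵖ = σᵖ' ; σᵖ' = σᵖ ; Nᵖ = Nᵖ
  ; spare = spare' ; spare' = spare ; all-live = all-live
  ; prefix-ρ = λ x e → let (p , p') = prefix-ρ x e in p' , p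
  ; suffix-ρ = λ x e → let (j , p , p') = suffix-ρ x e in j , p' , p
  ; prefix-σ = prefix-σ' ; prefix-σ' = prefix-σ ; suffix-σ = λ U j → sym (suffix-σ U j)
  ; game = EF-sym game }
  where open Split sp

Split⇒Agree : ∀ {ρ ρ' σ σ'} → Split {k} {m} L q us us' zs ρ ρ' σ σ' →
              Agree M N ⟨ us ++ zs , ρ , σ ⟩ ⟨ us' ++ zs , ρ' , σ' ⟩
Split⇒Agree {us = us} {us'} {zs} {ρ = ρ} {ρ'} {σ} {σ'} sp = record
  { order = λ x y _ _ → order x y ; letter = λ x _ → letter x ; member = λ U x _ _ → member U x }
  where
  open Split sp
  open Agree (EF-agree game) renaming (order to orderᵖ; letter to letterᵖ; member to memberᵖ)

  order : ∀ x y → ⌊ ρ x <? ρ y ⌋ ≡ ⌊ ρ' x <? ρ' y ⌋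
  order x y with inPrefix x in px | inPrefix y in py
  ... | true | true
    rewrite proj₁ (prefix-ρ x px) | proj₂ (prefix-ρ x px) | proj₁ (prefix-ρ y py) | proj₂ (prefix-ρ y py)
          | <?-posˡ us {zs} (ρᵖ x) (ρᵖ y) | <?-posˡ us' {zs} (ρᵖ' x) (ρᵖ' y) = orderᵖ x y px py
  ... | true | false with suffix-ρ y py
  ... | j , e , e'
    rewrite proj₁ (prefix-ρ x px) | proj₂ (prefix-ρ x px) | e | e'
          | <?-posˡʳ us {zs} (ρᵖ x) j | <?-posˡʳ us' {zs} (ρᵖ' x) j = refl
  order x y | false | true with suffix-ρ x px
  ... | j , e , e'
    rewrite e | e' | proj₁ (prefix-ρ y py) | proj₂ (prefix-ρ y py)
          | <?-posʳˡ us {zs} (ρᵖ y) j | <?-posʳˡ us' {zs} (ρᵖ' y) j = refl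
  order x y | false | false with suffix-ρ x px | suffix-ρ y py
  ... | j , e₁ , e₁' | j' , e₂ , e₂'
    rewrite e₁ | e₁' | e₂ | e₂' | <?-posʳ us {zs} j j' | <?-posʳ us' {zs} j j' = refl

  letter : ∀ x → lookup (us ++ zs) (ρ x) ≡ lookup (us' ++ zs) (ρ' x)
  letter x with inPrefix x in px
  ... | true rewrite proj₁ (prefix-ρ x px) | proj₂ (prefix-ρ x px)
                   | lookup-posˡ us {zs} (ρᵖ x) | lookup-posˡ us' {zs} (ρᵖ' x) = letterᵖ x px
  ... | false with suffix-ρ x px
  ... | j , e , e' rewrite e | e' | lookup-posʳ us {zs} j | lookup-posʳ us' {zs} j = refl

  member : ∀ U x → σ U (ρ x) ≡ σ' U (ρ' x)
  member U x with inPrefix x in px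
  ... | true rewrite proj₁ (prefix-ρ x px) | proj₂ (prefix-ρ x px)
                   | prefix-σ U (ρᵖ x) | prefix-σ' U (ρᵖ' x) =
    memberᵖ U x (all-live U) px
  ... | false with suffix-ρ x px
  ... | j , e , e' rewrite e | e' = suffix-σ U j

mutual
  Split⇒EF : ∀ {ρ ρ' σ σ'} → Split {k} {m} L q us us' zs ρ ρ' σ σ' →
             EF L q M N ⟨ us ++ zs , ρ , σ ⟩ ⟨ us' ++ zs , ρ' , σ' ⟩
  Split⇒EF {q = zero} sp = agree (Split⇒Agree sp)
  Split⇒EF {q = suc q} sp =
    rounds (Split⇒Agree sp) (Split-point-forth sp)
           (λ b → let (a , g) = Split-point-forth (Split-sym sp) b in a , EF-sym g)
           (Split-set-moves sp)

  Split-point-forth : ∀ {ρ ρ' σ σ'} → Split {k} {m} L (suc q) us us' zs ρ ρ' σ σ' →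
                      ∀ a → ∃ λ b → EF L q (true ∷ᶠ M) N ⟨ us ++ zs , a ∷ᶠ ρ , σ ⟩
                                                        ⟨ us' ++ zs , b ∷ᶠ ρ' , σ' ⟩
  Split-point-forth {us = us} {us'} sp a with position-++ us a | Split.game sp
  ... | inj₁ (i , a≡) | rounds _ forth _ _ =
    let (i' , g) = forth i in
    posˡ us' i' , Split⇒EF (record
      { inPrefix = true ∷ᶠ inPrefix ; ρᵖ = i ∷ᶠ ρᵖ ; ρᵖ' = i' ∷ᶠ ρᵖ'
      ; σᵖ = σᵖ ; σᵖ' = σᵖ' ; Nᵖ = Nᵖ
      ; spare = spare ; spare' = spare' ; all-live = all-live
      ; prefix-σ = prefix-σ ; prefix-σ' = prefix-σ' ; suffix-σ = suffix-σ
      ; prefix-ρ = λ { zero _ → a≡ , refl ; (suc x) e → prefix-ρ x e }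
      ; suffix-ρ = λ { (suc x) e → suffix-ρ x e }
      ; game = g })
    where open Split sp
  ... | inj₂ (j , a≡) | g =
    posʳ us' j , Split⇒EF (record
      { inPrefix = false ∷ᶠ inPrefix ; ρᵖ = spare ∷ᶠ ρᵖ ; ρᵖ' = spare' ∷ᶠ ρᵖ'
      ; σᵖ = σᵖ ; σᵖ' = σᵖ' ; Nᵖ = Nᵖ
      ; spare = spare ; spare' = spare' ; all-live = all-live
      ; prefix-σ = prefix-σ ; prefix-σ' = prefix-σ' ; suffix-σ = suffix-σ
      ; prefix-ρ = λ { (suc x) e → prefix-ρ x e }
      ; suffix-ρ = λ { zero _ → j , a≡ , refl ; (suc x) e → suffix-ρ x e }
      ; game = EF-dead-var spare spare' (EF-lower g) })
    where open Split sp

  Split-set-moves : ∀ {ρ ρ' σ σ'} → Split {k} {m} L (suc q) us us' zs ρ ρ' σ σ' →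
                    SetMoves L q M N ⟨ us ++ zs , ρ , σ ⟩ ⟨ us' ++ zs , ρ' , σ' ⟩
  Split-set-moves {L = fo} sp = none
  Split-set-moves {L = mso} sp =
    sets (Split-set-forth sp) (λ S' → let (S , g) = Split-set-forth (Split-sym sp) S' in S , EF-sym g)

  Split-set-forth : ∀ {ρ ρ' σ σ'} → Split {k} {m} mso (suc q) us us' zs ρ ρ' σ σ' →
                    ∀ S → ∃ λ S' → EF mso q M (true ∷ᶠ N) ⟨ us ++ zs , ρ , S ∷ᶠ σ ⟩
                                                          ⟨ us' ++ zs , ρ' , S' ∷ᶠ σ' ⟩
  Split-set-forth {us = us} {us'} {zs} sp S with Split.game sp
  ... | rounds _ _ _ (sets forth _) =
    let (Sᵖ' , g) = forth (S ∘ posˡ us) ; S' = joinSets us' Sᵖ' (S ∘ posʳ us) in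
    S' , Split⇒EF (record
      { inPrefix = inPrefix ; ρᵖ = ρᵖ ; ρᵖ' = ρᵖ' ; spare = spare ; spare' = spare'
      ; prefix-ρ = prefix-ρ ; suffix-ρ = suffix-ρ
      ; σᵖ = (S ∘ posˡ us) ∷ᶠ σᵖ ; σᵖ' = Sᵖ' ∷ᶠ σᵖ' ; Nᵖ = true ∷ᶠ Nᵖ
      ; all-live = λ { zero → refl ; (suc U) → all-live U }
      ; prefix-σ = λ { zero i → refl ; (suc U) i → prefix-σ U i }
      ; prefix-σ' = λ { zero i → joinSets-posˡ us' Sᵖ' _ i ; (suc U) i → prefix-σ' U i }
      ; suffix-σ = λ { zero j → sym (joinSets-posʳ us' {zs} Sᵖ' _ j) ; (suc U) j → suffix-σ U j }
      ; game = g })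
    where open Split sp

closed : List Letter → Interp 0 0
closed xs = ⟨ xs , (λ ()) , (λ ()) ⟩

typeCode-≡⇒EF-++ : ∀ {u u'} {M N : Fin 0 → Bool} {ρ ρ' σ σ'} →
                   typeCode L q (closed (u ∷ us)) ≡ typeCode L q (closed (u' ∷ us')) →
                   EF L q M N ⟨ u ∷ us ++ zs , ρ , σ ⟩ ⟨ u' ∷ us' ++ zs , ρ' , σ' ⟩
typeCode-≡⇒EF-++ {L = L} {q} e = Split⇒EF record
  { inPrefix = λ () ; ρᵖ = λ () ; ρᵖ' = λ () ; σᵖ = λ () ; σᵖ' = λ () ; Nᵖ = λ ()
  ; spare = zero ; spare' = zero ; all-live = λ ()
  ; prefix-ρ = λ () ; suffix-ρ = λ () ; prefix-σ = λ () ; prefix-σ' = λ () ; suffix-σ = λ ()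
  ; game = typeCode-≡⇒EF L q _ _ zero zero e }

⊨-++ : ∀ {u u'} (φ : Sentence L) → rank φ ≤ q →
       typeCode L q (closed (u ∷ us)) ≡ typeCode L q (closed (u' ∷ us')) →
       (u List⁺.∷ us ++ zs) ⊨ φ → (u' List⁺.∷ us' ++ zs) ⊨ φ
⊨-++ φ rank≤q e sat =
  trans (sym (EF⇒eval≡ {M = λ ()} {N = λ ()} φ (λ ()) (λ ()) rank≤q (typeCode-≡⇒EF-++ e))) sat

-- Pumping

take-extends : (xs : List A) {i j : ℕ} → i < j → j ≤ length xs →
               ∃ λ loop → 0 < length loop × take j xs ≡ take i xs ++ loop
take-extends (x ∷ xs) {zero} {suc j} _ _ = x ∷ take j xs , s≤s z≤n , refl
take-extends (x ∷ xs) {suc i} {suc j} (s≤s i<j) (s≤s j≤) =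
  let (loop , nonempty , e) = take-extends xs i<j j≤ in loop , nonempty , cong (x ∷_) e

repeat : ℕ → List A → List A
repeat zero ys = []
repeat (suc t) ys = ys ++ repeat t ys

repeat-length : ∀ t {ys : List A} → 0 < length ys → t ≤ length (repeat t ys)
repeat-length zero _ = z≤n
repeat-length (suc t) {ys} nonempty =
  ≤-trans (+-mono-≤ nonempty (repeat-length t nonempty)) (≤-reflexive (sym (length-++ ys)))

record Loop (L : Logic) (q : ℕ) (u : Letter) (xs : List Letter) : Set where
  field
    prefix loop suffix : List Letter
    loop-nonempty : 0 < length loop
    decomposition : xs ≡ (prefix ++ loop) ++ suffix
    same-type : typeCode L q (closed (u ∷ prefix)) ≡ typeCode L q (closed (u ∷ prefix ++ loop))

find-loop : ∀ u xs → typeCount L q 0 0 ≤ length xs → Loop L q u xs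
find-loop {L = L} {q} u xs count≤
  with pigeonhole (s≤s count≤) (λ t → typeCode L q (closed (u ∷ take (toℕ t) xs)))
... | i , j , i<j , same =
  let (loop , nonempty , e) = take-extends xs i<j (toℕ≤pred[n] j) in
  record
    { prefix = take (toℕ i) xs ; loop = loop ; suffix = drop (toℕ j) xs ; loop-nonempty = nonempty
    ; decomposition = trans (sym (take++drop≡id (toℕ j) xs)) (cong (_++ drop (toℕ j) xs) e)
    ; same-type = trans same (cong (λ ys → typeCode L q (closed (u ∷ ys))) e) }

module Pumping {L} (φ : Sentence L) {q} (rank≤q : rank φ ≤ q) where

  cut-loop : ∀ {u xs} (lp : Loop L q u xs) → (u List⁺.∷ xs) ⊨ φ →
             (u List⁺.∷ Loop.prefix lp ++ Loop.suffix lp) ⊨ φ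
  cut-loop {u} lp sat = ⊨-++ φ rank≤q (sym same-type) (subst (λ ys → (u List⁺.∷ ys) ⊨ φ) decomposition sat)
    where open Loop lp

  shorter-model : ∀ {u xs} → typeCount L q 0 0 ≤ length xs → (u List⁺.∷ xs) ⊨ φ →
                  ∃ λ ys → length ys < length xs × (u List⁺.∷ ys) ⊨ φ
  shorter-model {u} {xs} count≤ sat = prefix ++ suffix , shorter , cut-loop lp sat
    where
    lp = find-loop {L = L} {q} u xs count≤
    open Loop lp
    shorter : length (prefix ++ suffix) < length xs
    shorter = begin-strict
      length (prefix ++ suffix)                     ≡⟨ length-++ prefix ⟩
      length prefix + length suffix                 <⟨ +-monoˡ-< _ (m<m+n (length prefix) loop-nonempty) ⟩
      length prefix + length loop + length suffix   ≡⟨ cong (_+ length suffix) (length-++ prefix) ⟨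
      length (prefix ++ loop) + length suffix       ≡⟨ length-++ (prefix ++ loop) ⟨
      length ((prefix ++ loop) ++ suffix)           ≡⟨ cong length decomposition ⟨
      length xs                                     ∎
      where open ≤-Reasoning

  small-model : ∀ {u xs} → Acc _<_ (length xs) → (u List⁺.∷ xs) ⊨ φ →
                ∃ λ v → v ⊨ φ × ∣ v ∣ ≤ typeCount L q 0 0
  small-model {u} {xs} (acc smaller) sat with typeCount L q 0 0 ≤? length xs
  ... | no count≰ = u List⁺.∷ xs , sat , ≰⇒> count≰
  ... | yes count≤ = let (ys , shorter , sat') = shorter-model count≤ sat in small-model (smaller shorter) sat'

  defined-word-bound : ∀ {w} → Defines φ w → ∣ w ∣ ≤ typeCount L q 0 0
  defined-word-bound {u List⁺.∷ xs} (sat , unique) with typeCount L q 0 0 ≤? length xs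
  ... | no count≰ = ≰⇒> count≰
  ... | yes count≤ =
    let (ys , shorter , sat') = shorter-model count≤ sat in
    ⊥-elim (<-irrefl (suc-injective (cong ∣_∣ (unique _ sat'))) shorter)

  long-models : ∀ {u xs} → typeCount L q 0 0 ≤ length xs → (u List⁺.∷ xs) ⊨ φ →
                ∀ N → ∃ λ v → v ⊨ φ × N ≤ ∣ v ∣
  long-models {u} {xs} count≤ sat N = u List⁺.∷ prefix ++ repeat N loop ++ suffix , pumped N , long
    where
    lp = find-loop {L = L} {q} u xs count≤
    open Loop lp
    pumped : ∀ t → (u List⁺.∷ prefix ++ repeat t loop ++ suffix) ⊨ φ
    pumped zero = cut-loop lp sat
    pumped (suc t) =
      subst (λ ys → (u List⁺.∷ ys) ⊨ φ)
            (trans (++-assoc prefix loop _) (cong (prefix ++_) (sym (++-assoc loop (repeat t loop) suffix))))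
            (⊨-++ φ rank≤q same-type (pumped t))
    long : N ≤ ∣ u List⁺.∷ prefix ++ repeat N loop ++ suffix ∣
    long = m≤n⇒m≤1+n (≤-trans (repeat-length N loop-nonempty)
                        (≤-trans (length-++-≤ˡ (repeat N loop)) (length-++-≤ʳ (repeat N loop ++ suffix) {prefix})))

-- Tower arithmetic

fo-exponent : ℕ → ℕ → ℕ
fo-exponent zero s = s * s
fo-exponent (suc j) s = 2 ^ fo-exponent j s

typeCount-fo≤ : ∀ j k → typeCount fo j k 0 ≤ 2 ^ fo-exponent j (j + k)
typeCount-fo≤ zero k = ≤-reflexive (trans (*-identityʳ _) (^-*-assoc 2 k k))
typeCount-fo≤ (suc j) k =
  ^-monoʳ-≤ 2 (subst (λ s → typeCount fo j (suc k) 0 ≤ 2 ^ fo-exponent j s) (+-suc j k)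
                     (typeCount-fo≤ j (suc k)))

fo-exponent≤tower : ∀ j {s L} → s * s ≤ tower L → fo-exponent j s ≤ tower (j + L)
fo-exponent≤tower zero h = h
fo-exponent≤tower (suc j) h = ^-monoʳ-≤ 2 (fo-exponent≤tower j h)

mso-exponent : ℕ → ℕ → ℕ
mso-exponent zero s = s * s
mso-exponent (suc j) s = 2 ^ suc (mso-exponent j s)

typeCount-mso≤ : ∀ j k m → typeCount mso j k m ≤ 2 ^ mso-exponent j (j + (k + m))
typeCount-mso≤ zero k m = begin
  (2 ^ k) ^ k * (2 ^ k) ^ m  ≡⟨ cong₂ _*_ (^-*-assoc 2 k k) (^-*-assoc 2 k m) ⟩
  2 ^ (k * k) * 2 ^ (k * m)  ≡⟨ ^-distribˡ-+-* 2 (k * k) (k * m) ⟨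
  2 ^ (k * k + k * m)        ≡⟨ cong (2 ^_) (*-distribˡ-+ k k m) ⟨
  2 ^ (k * (k + m))          ≤⟨ ^-monoʳ-≤ 2 (*-monoˡ-≤ (k + m) (m≤m+n k m)) ⟩
  2 ^ ((k + m) * (k + m))    ∎
  where open ≤-Reasoning
typeCount-mso≤ (suc j) k m = begin
  2 ^ typeCount mso j (suc k) m * 2 ^ typeCount mso j k (suc m)
    ≡⟨ ^-distribˡ-+-* 2 (typeCount mso j (suc k) m) _ ⟨
  2 ^ (typeCount mso j (suc k) m + typeCount mso j k (suc m))
    ≤⟨ ^-monoʳ-≤ 2 (+-mono-≤ (subst (λ s → typeCount mso j (suc k) m ≤ 2 ^ mso-exponent j s) (+-suc j (k + m))
                                     (typeCount-mso≤ j (suc k) m))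
                              (subst (λ s → typeCount mso j k (suc m) ≤ 2 ^ mso-exponent j s)
                                     (trans (cong (j +_) (+-suc k m)) (+-suc j (k + m)))
                                     (typeCount-mso≤ j k (suc m)))) ⟩
  2 ^ (X + X)                ≡⟨ cong (λ y → 2 ^ (X + y)) (+-identityʳ X) ⟨
  2 ^ (2 * X)                ∎
  where
  open ≤-Reasoning
  X = 2 ^ mso-exponent j (suc (j + (k + m)))

2^[1+n]+2≤2^[2+n] : ∀ n → 2 ^ suc n + 2 ≤ 2 ^ suc (suc n)
2^[1+n]+2≤2^[2+n] n = begin
  2 ^ suc n + 2            ≤⟨ +-monoʳ-≤ (2 ^ suc n) (*-monoʳ-≤ 2 (m^n>0 2 n)) ⟩
  2 ^ suc n + 2 ^ suc n    ≡⟨ cong (2 ^ suc n +_) (+-identityʳ (2 ^ suc n)) ⟨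
  2 ^ suc (suc n)          ∎
  where open ≤-Reasoning

mso-exponent≤tower : ∀ j {s L} → s * s + 2 ≤ tower L → mso-exponent j s + 2 ≤ tower (j + L)
mso-exponent≤tower zero h = h
mso-exponent≤tower (suc j) {s} h =
  ≤-trans (2^[1+n]+2≤2^[2+n] (mso-exponent j s))
          (^-monoʳ-≤ 2 (≤-trans (≤-reflexive (+-comm 2 (mso-exponent j s))) (mso-exponent≤tower j h)))

logStarFrom-spec : ∀ a b fuel m → a ≤ b * tower (m + fuel) → a ≤ b * tower (logStarFrom a b fuel m)
logStarFrom-spec a b zero m h = subst (λ t → a ≤ b * tower t) (+-identityʳ m) h
logStarFrom-spec a b (suc fuel) m h with a ≤ᵇ b * tower m in found
... | true = ≤ᵇ⇒≤ a (b * tower m) (subst T (sym found) _)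
... | false = logStarFrom-spec a b fuel (suc m) (subst (λ t → a ≤ b * tower t) (+-suc m fuel) h)

n<2^n : ∀ n → n < 2 ^ n
n<2^n zero = s≤s z≤n
n<2^n (suc n) = begin-strict
  suc n          ≤⟨ n<2^n n ⟩
  2 ^ n          <⟨ m<m+n (2 ^ n) (≤-trans (m^n>0 2 n) (≤-reflexive (sym (+-identityʳ (2 ^ n))))) ⟩
  2 ^ suc n      ∎
  where open ≤-Reasoning

n≤tower : ∀ n → n ≤ tower n
n≤tower zero = z≤n
n≤tower (suc n) = ≤-<-trans (n≤tower n) (n<2^n (tower n))

logStarFrac-spec : ∀ a → a ≤ 4 * tower (logStarFrac a 4)
logStarFrac-spec a = logStarFrom-spec a 4 a 0 (≤-trans (n≤tower a) (m≤n*m (tower a) 4))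

2*ceilHalf≤ : ∀ n → 2 * ceilHalf n ≤ n + 1
2*ceilHalf≤ n = ≤-trans (≤-reflexive (*-comm 2 (ceilHalf n))) (m/n*n≤m (n + 1) 2)

ceilHalf²≤tower : ∀ n → ceilHalf n * ceilHalf n ≤ tower (logStarFrac (n * n + 2 * n) 4)
ceilHalf²≤tower n = ≤-pred (*-cancelˡ-< 4 _ _ (begin-strict
  4 * (h * h)             ≡⟨ solve 1 (λ h → con 4 :* (h :* h) := (con 2 :* h) :* (con 2 :* h)) refl h ⟩
  (2 * h) * (2 * h)       ≤⟨ *-mono-≤ (2*ceilHalf≤ n) (2*ceilHalf≤ n) ⟩
  (n + 1) * (n + 1)       ≡⟨ solve 1 (λ n → (n :+ con 1) :* (n :+ con 1) := (n :* n :+ con 2 :* n) :+ con 1)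
                                     refl n ⟩
  (n * n + 2 * n) + 1     ≤⟨ +-monoˡ-≤ 1 (logStarFrac-spec (n * n + 2 * n)) ⟩
  4 * t + 1               <⟨ +-monoʳ-< (4 * t) (s≤s (s≤s z≤n)) ⟩
  4 * t + 4               ≡⟨ trans (+-comm (4 * t) 4) (sym (*-suc 4 t)) ⟩
  4 * suc t               ∎))
  where
  open ≤-Reasoning
  h = ceilHalf n
  t = tower (logStarFrac (n * n + 2 * n) 4)

ceilHalf²+2≤tower : ∀ n → 1 ≤ n → ceilHalf n * ceilHalf n + 2 ≤ tower (logStarFrac ((n + 2) * (n + 2)) 4)
ceilHalf²+2≤tower n 1≤n = begin
  h * h + 2               ≤⟨ +-monoʳ-≤ (h * h) (s≤s 1≤h) ⟩
  h * h + suc h           ≡⟨ +-comm (h * h) (suc h) ⟩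
  suc (h + h * h)         ≤⟨ *-cancelˡ-< 4 _ _ (begin-strict
      4 * (h + h * h)               <⟨ n<1+n _ ⟩
      suc (4 * (h + h * h))         ≡⟨ solve 1 (λ h → con 1 :+ con 4 :* (h :+ h :* h)
                                                     := (con 2 :* h :+ con 1) :* (con 2 :* h :+ con 1)) refl h ⟩
      (2 * h + 1) * (2 * h + 1)     ≤⟨ *-mono-≤ (+-monoˡ-≤ 1 (2*ceilHalf≤ n))
                                                (+-monoˡ-≤ 1 (2*ceilHalf≤ n)) ⟩
      (n + 1 + 1) * (n + 1 + 1)     ≡⟨ cong (λ x → x * x) (+-assoc n 1 1) ⟩
      (n + 2) * (n + 2)             ≤⟨ logStarFrac-spec ((n + 2) * (n + 2)) ⟩
      4 * t                         ∎) ⟩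
  t                       ∎
  where
  open ≤-Reasoning
  h = ceilHalf n
  t = tower (logStarFrac ((n + 2) * (n + 2)) 4)
  1≤h : 1 ≤ h
  1≤h = m≥n⇒m/n>0 {n + 1} {2} (+-monoˡ-≤ 1 1≤n)

tower≥1 : ∀ n → 1 ≤ tower n
tower≥1 zero = ≤-refl
tower≥1 (suc n) = m^n>0 2 (tower n)

typeCount-fo≤boundFO : ∀ n → typeCount fo (ceilHalf n) 0 0 ≤ boundFO n
typeCount-fo≤boundFO n = begin
  typeCount fo h 0 0            ≤⟨ typeCount-fo≤ h 0 ⟩
  2 ^ fo-exponent h (h + 0)     ≡⟨ cong (λ s → 2 ^ fo-exponent h s) (+-identityʳ h) ⟩
  2 ^ fo-exponent h h           ≤⟨ ^-monoʳ-≤ 2 (fo-exponent≤tower h (ceilHalf²≤tower n)) ⟩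
  tower (suc (h + t))           ≡⟨ cong tower (+-comm 1 (h + t)) ⟩
  tower (h + t + 1)             ∎
  where
  open ≤-Reasoning
  h = ceilHalf n
  t = logStarFrac (n * n + 2 * n) 4

typeCount-mso≤boundMSO : ∀ n → typeCount mso (ceilHalf n) 0 0 ≤ boundMSO n
typeCount-mso≤boundMSO zero = tower≥1 (0 + logStarFrac (2 * 2) 4 + 1)
typeCount-mso≤boundMSO n@(suc _) = begin
  typeCount mso h 0 0           ≤⟨ typeCount-mso≤ h 0 0 ⟩
  2 ^ mso-exponent h (h + 0)    ≡⟨ cong (λ s → 2 ^ mso-exponent h s) (+-identityʳ h) ⟩
  2 ^ mso-exponent h h          ≤⟨ ^-monoʳ-≤ 2 (≤-trans (m≤m+n _ 2)
                                    (mso-exponent≤tower h (ceilHalf²+2≤tower n (s≤s z≤n)))) ⟩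
  tower (suc (h + t))           ≡⟨ cong tower (+-comm 1 (h + t)) ⟩
  tower (h + t + 1)             ∎
  where
  open ≤-Reasoning
  h = ceilHalf n
  t = logStarFrac ((n + 2) * (n + 2)) 4

bounds-from-typeCount : ∀ L n B → typeCount L (ceilHalf n) 0 0 ≤ B → DN≤ L n B × LS≤ L n B × H≤ L n B
bounds-from-typeCount L n B count≤B =
  (λ φ w sz≤n defines → ≤-trans (defined-word-bound φ (rank≤ceilHalf φ sz≤n) defines) count≤B) ,
  (λ φ w sz≤n sat →
     let (v , sat' , short) = small-model φ (rank≤ceilHalf φ sz≤n) (<-wellFounded _) sat in
     v , sat' , ≤-trans short count≤B) ,
  (λ φ w sz≤n sat B<∣w∣ →
     long-models φ (rank≤ceilHalf φ sz≤n) (≤-trans count≤B (≤-pred B<∣w∣)) sat)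
  where open Pumping

corollary4 : ∀ (n : ℕ) →
    (DN≤ fo n (boundFO n) × LS≤ fo n (boundFO n) × H≤ fo n (boundFO n)) ×
    (DN≤ mso n (boundMSO n) × LS≤ mso n (boundMSO n) × H≤ mso n (boundMSO n))
corollary4 n =
  bounds-from-typeCount fo n (boundFO n) (typeCount-fo≤boundFO n) ,
  bounds-from-typeCount mso n (boundMSO n) (typeCount-mso≤boundMSO n)
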